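{- Let $\Sigma=(\Gamma,\sigma)$ be a signed simple graph, let $B=(\Gamma,\tau)$ be any orientation of $\Sigma$, and let $n\ge1$. Under the bijection sending an $n$-edge coloring $\gamma$ of $\Sigma$ to the vertex coloring $c(\ell_e)=\tau(v,e)\gamma(v,e)$ of $\Sigma_{L(B)}$ (for $v$ an endpoint of $e$), the antiproper edge colorings of $\Sigma$ correspond exactly to the proper vertex colorings of $\Sigma_{L(B)}$, a representative of the line graph $\Lambda(\Sigma)$.
   Context: A signed graph is $\Sigma=(\Gamma,\sigma)$ with $\Gamma$ a finite simple graph and $\sigma:E(\Gamma)\to\{+,-\}$. An incidence is a pair $(v,e)$ with $v$ an endpoint of $e$. For $n\ge1$, $M_n=\{0,\pm1,\ldots,\pm k\}$ if $n=2k+1$ and $M_n=\{\pm1,\ldots,\pm k\}$ if $n=2k$. An $n$-edge coloring of $\Sigma$ is a map $\gamma$ from incidences to $M_n$ with $\gamma(v,e)=-\sigma(e)\gamma(w,e)$ for each edge $e$ with endpoints $v,w$; it is antiproper if $\gamma(v,e)\neq-\gamma(v,f)$ for distinct edges $e,f$ sharing an endpoint $v$. An $n$-vertex coloring of a signed graph $(\Gamma',\sigma')$ is a map $c:V(\Gamma')\to M_n$; it is proper if $c(x)\neq\sigma'(xy)c(y)$ for every edge $xy$. A bidirected graph is $B=(\Gamma,\tau)$ with $\tau$ assigning $\pm$ to each incidence; $B$ is an orientation of $\Sigma$ if $\sigma(e)=-\tau(v,e)\tau(w,e)$ for each edge $e$ with endpoints $v,w$. The line graph $L(\Gamma)$ has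 a vertex $\ell_e$ for each edge $e$, with $\ell_e\ell_f$ an edge iff $e,f$ share an endpoint. The signed graph $\Sigma_{L(B)}$ is $L(\Gamma)$ with sign $-\tau(v,e)\tau(v,f)$ on $\ell_e\ell_f$, where $v$ is the common endpoint of $e,f$. The line graph $\Lambda(\Sigma)$ is the switching class of $\Sigma_{L(B)}$ (switching at a vertex negates the signs of all edges at it). -}

module Defs where

open import Data.Nat using (ℕ; zero; suc; _≤_; _*_; _+_)
open import Data.Integer using (ℤ; ∣_∣; -_) renaming (_*_ to _*ℤ_)
open import Data.Integer as ℤ using (+_)
open import Data.Fin using (Fin)
open import Data.Product using (Σ; ∃; ∃-syntax; _×_)
open import Data.Sum using (_⊎_)
open import Relation.Binary.PropositionalEquality using (_≡_; _≢_)
open import Relation.Nullary using (¬_)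
open import Level using (Level)

data Sign : Set where
  plus minus : Sign

⟦_⟧ : Sign → ℤ
⟦ plus ⟧ = + 1
⟦ minus ⟧ = - (+ 1)

neg : Sign → Sign
neg plus = minus
neg minus = plus

_·_ : Sign → Sign → Sign
plus · s = s
minus · s = neg s

InM : ℕ → ℤ → Set
InM n z =
  (∃[ k ] (n ≡ 2 * k + 1 × ∣ z ∣ ≤ k)) ⊎
  (∃[ k ] (n ≡ 2 * k × 1 ≤ ∣ z ∣ × ∣ z ∣ ≤ k))

-- Each edge has two ends (Side), giving its two distinct endpoints;
-- an incidence (v,e) is encoded as (e, s) with v = end e s
-- (bijective since there are no loops).

data Side : Set where
  L R : Side

flip : Side → Side
flip L = R
flip R = L

record SignedSimpleGraph : Set where
  field
    nV       : ℕ
    m        : ℕ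
    end      : Fin m → Side → Fin nV
    loopless : ∀ e → end e L ≢ end e R
    simple   : ∀ e f →
               (end e L ≡ end f L × end e R ≡ end f R) ⊎
               (end e L ≡ end f R × end e R ≡ end f L) → e ≡ f
    σ        : Fin m → Sign
open SignedSimpleGraph public

record Orientation (S : SignedSimpleGraph) : Set where
  field
    τ      : Fin (m S) → Side → Sign
    orient : ∀ e → σ S e ≡ neg (τ e L · τ e R)
open Orientation public

IsEdgeColoring : (S : SignedSimpleGraph) → ℕ → (Fin (m S) → Side → ℤ) → Set
IsEdgeColoring S n γ =
  (∀ e s → InM n (γ e s)) ×
  (∀ e s → γ e s ≡ - (⟦ σ S e ⟧ *ℤ γ e (flip s)))

IsAntiproper : (S : SignedSimpleGraph) → (Fin (m S) → Side → ℤ) → Set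
IsAntiproper S γ =
  ∀ e f s t → e ≢ f → end S e s ≡ end S f t → γ e s ≢ - γ f t

record SignedGraph : Set₁ where
  field
    Vx  : Set
    Adj : Vx → Vx → Set
    sgn : ∀ {x y} → Adj x y → Sign
open SignedGraph public

IsVertexColoring : (G : SignedGraph) → ℕ → (Vx G → ℤ) → Set
IsVertexColoring G n c = ∀ x → InM n (c x)

IsProper : (G : SignedGraph) → (Vx G → ℤ) → Set
IsProper G c = ∀ x y (a : Adj G x y) → c x ≢ ⟦ sgn G a ⟧ *ℤ c y

LineAdj : (S : SignedSimpleGraph) → Fin (m S) → Fin (m S) → Set
LineAdj S e f = e ≢ f × Σ Side λ s → Σ Side λ t → end S e s ≡ end S f t

lineSign : (S : SignedSimpleGraph) (B : Orientation S) →
           ∀ {e f} → LineAdj S e f → Sign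
lineSign S B {e} {f} (_ Data.Product., s Data.Product., t Data.Product., _) =
  neg (τ B e s · τ B f t)

ΣL : (S : SignedSimpleGraph) → Orientation S → SignedGraph
ΣL S B = record { Vx = Fin (m S) ; Adj = LineAdj S ; sgn = lineSign S B }

-- The map γ ↦ c,  c(ℓ_e) = τ(v,e) γ(v,e)  (computed at the L-end;
-- independence of the chosen endpoint is part of the theorem).

toVertex : (S : SignedSimpleGraph) → Orientation S →
           (Fin (m S) → Side → ℤ) → Fin (m S) → ℤ
toVertex S B γ e = ⟦ τ B e L ⟧ *ℤ γ e L

module Submission where

open import Defs
open import Data.Nat using (ℕ; _≤_)
open import Data.Integer using (ℤ; -_; ∣_∣) renaming (_*_ to _*ℤ_)
open import Data.Integer.Properties
  using (*-assoc; *-identityˡ; neg-involutive; neg-distribˡ-*; neg-distribʳ-*; abs-*)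
import Data.Nat as ℕ
import Data.Nat.Properties as ℕ
open import Data.Fin using (Fin)
open import Data.Product using (∃-syntax; _×_; _,_; proj₁)
open import Data.Sum using (inj₁; inj₂)
open import Relation.Binary.PropositionalEquality
  using (_≡_; refl; sym; trans; cong; subst; module ≡-Reasoning)
open import Relation.Nullary.Negation using (contraposition)
open import Function.Bundles using (_⇔_; mk⇔; Equivalence)

-- Multiplying by ⟦ a ⟧ is an involution of ℤ that preserves
-- absolute values, so c(ℓ_e) = τ(v,e) γ(v,e) can be inverted incidence by
-- incidence.  With σ(e) = −τ(v,e)τ(w,e), the edge-colouring condition
-- γ(v,e) = −σ(e) γ(w,e) says exactly τ(v,e)γ(v,e) = τ(w,e)γ(w,e), so c is
-- well defined; and with c(ℓ_e) = τ(v,e)γ(v,e), c(ℓ_f) = τ(v,f)γ(v,f), the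
-- improper relation c(ℓ_e) = −τ(v,e)τ(v,f) c(ℓ_f) says exactly
-- γ(v,e) = −γ(v,f).

·-comm : ∀ a b → a · b ≡ b · a
·-comm plus  plus  = refl
·-comm plus  minus = refl
·-comm minus plus  = refl
·-comm minus minus = refl

⟦·⟧ : ∀ a b → ⟦ a · b ⟧ ≡ ⟦ a ⟧ *ℤ ⟦ b ⟧
⟦·⟧ plus  plus  = refl
⟦·⟧ plus  minus = refl
⟦·⟧ minus plus  = refl
⟦·⟧ minus minus = refl

⟦neg⟧ : ∀ a → ⟦ neg a ⟧ ≡ - ⟦ a ⟧
⟦neg⟧ plus  = refl
⟦neg⟧ minus = refl

⟦⟧*⟦⟧ : ∀ a → ⟦ a ⟧ *ℤ ⟦ a ⟧ ≡ ⟦ plus ⟧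
⟦⟧*⟦⟧ plus  = refl
⟦⟧*⟦⟧ minus = refl

∣⟦⟧*∣ : ∀ a x → ∣ ⟦ a ⟧ *ℤ x ∣ ≡ ∣ x ∣
∣⟦⟧*∣ a x = trans (abs-* ⟦ a ⟧ x) (trans (cong (ℕ._* ∣ x ∣) (∣⟦⟧∣ a)) (ℕ.*-identityˡ ∣ x ∣))
  where
  ∣⟦⟧∣ : ∀ a → ∣ ⟦ a ⟧ ∣ ≡ 1
  ∣⟦⟧∣ plus  = refl
  ∣⟦⟧∣ minus = refl

⟦⟧*-involutive : ∀ a x → ⟦ a ⟧ *ℤ (⟦ a ⟧ *ℤ x) ≡ x
⟦⟧*-involutive a x = begin
  ⟦ a ⟧ *ℤ (⟦ a ⟧ *ℤ x)  ≡⟨ sym (*-assoc ⟦ a ⟧ ⟦ a ⟧ x) ⟩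
  ⟦ a ⟧ *ℤ ⟦ a ⟧ *ℤ x    ≡⟨ cong (_*ℤ x) (⟦⟧*⟦⟧ a) ⟩
  ⟦ plus ⟧ *ℤ x          ≡⟨ *-identityˡ x ⟩
  x                      ∎
  where open ≡-Reasoning

⟦⟧*-injective : ∀ a {x y} → ⟦ a ⟧ *ℤ x ≡ ⟦ a ⟧ *ℤ y → x ≡ y
⟦⟧*-injective a {x} {y} eq = begin
  x                      ≡⟨ sym (⟦⟧*-involutive a x) ⟩
  ⟦ a ⟧ *ℤ (⟦ a ⟧ *ℤ x)  ≡⟨ cong (⟦ a ⟧ *ℤ_) eq ⟩
  ⟦ a ⟧ *ℤ (⟦ a ⟧ *ℤ y)  ≡⟨ ⟦⟧*-involutive a y ⟩
  y                      ∎
  where open ≡-Reasoning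

≡⟦⟧*⇔⟦⟧*≡ : ∀ a {x y} → (x ≡ ⟦ a ⟧ *ℤ y) ⇔ (⟦ a ⟧ *ℤ x ≡ y)
≡⟦⟧*⇔⟦⟧*≡ a {x} {y} = mk⇔
  (λ eq → trans (cong (⟦ a ⟧ *ℤ_) eq) (⟦⟧*-involutive a y))
  (λ eq → trans (sym (⟦⟧*-involutive a x)) (cong (⟦ a ⟧ *ℤ_) eq))

-‿⟦neg·⟧* : ∀ a b y → - (⟦ neg (a · b) ⟧ *ℤ y) ≡ ⟦ a ⟧ *ℤ (⟦ b ⟧ *ℤ y)
-‿⟦neg·⟧* a b y = begin
  - (⟦ neg (a · b) ⟧ *ℤ y)    ≡⟨ cong (λ z → - (z *ℤ y)) (⟦neg⟧ (a · b)) ⟩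
  - (- ⟦ a · b ⟧ *ℤ y)        ≡⟨ cong -_ (sym (neg-distribˡ-* ⟦ a · b ⟧ y)) ⟩
  - - (⟦ a · b ⟧ *ℤ y)        ≡⟨ neg-involutive _ ⟩
  ⟦ a · b ⟧ *ℤ y              ≡⟨ cong (_*ℤ y) (⟦·⟧ a b) ⟩
  ⟦ a ⟧ *ℤ ⟦ b ⟧ *ℤ y         ≡⟨ *-assoc ⟦ a ⟧ ⟦ b ⟧ y ⟩
  ⟦ a ⟧ *ℤ (⟦ b ⟧ *ℤ y)       ∎
  where open ≡-Reasoning

edge-condition⇔ : ∀ a b {x y} →
  (x ≡ - (⟦ neg (a · b) ⟧ *ℤ y)) ⇔ (⟦ a ⟧ *ℤ x ≡ ⟦ b ⟧ *ℤ y)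
edge-condition⇔ a b {x} {y} rewrite -‿⟦neg·⟧* a b y = ≡⟦⟧*⇔⟦⟧*≡ a

⟦neg·⟧*⟦⟧* : ∀ a b v → ⟦ neg (a · b) ⟧ *ℤ (⟦ b ⟧ *ℤ v) ≡ ⟦ a ⟧ *ℤ (- v)
⟦neg·⟧*⟦⟧* a b v = begin
  ⟦ neg (a · b) ⟧ *ℤ (⟦ b ⟧ *ℤ v)      ≡⟨ sym (neg-involutive _) ⟩
  - - (⟦ neg (a · b) ⟧ *ℤ (⟦ b ⟧ *ℤ v)) ≡⟨ cong -_ (-‿⟦neg·⟧* a b (⟦ b ⟧ *ℤ v)) ⟩
  - (⟦ a ⟧ *ℤ (⟦ b ⟧ *ℤ (⟦ b ⟧ *ℤ v))) ≡⟨ cong (λ z → - (⟦ a ⟧ *ℤ z)) (⟦⟧*-involutive b v) ⟩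
  - (⟦ a ⟧ *ℤ v)                      ≡⟨ neg-distribʳ-* ⟦ a ⟧ v ⟩
  ⟦ a ⟧ *ℤ (- v)                      ∎
  where open ≡-Reasoning

line-condition⇔ : ∀ a b {u v} →
  (⟦ a ⟧ *ℤ u ≡ ⟦ neg (a · b) ⟧ *ℤ (⟦ b ⟧ *ℤ v)) ⇔ (u ≡ - v)
line-condition⇔ a b {u} {v} rewrite ⟦neg·⟧*⟦⟧* a b v =
  mk⇔ (⟦⟧*-injective a) (cong (⟦ a ⟧ *ℤ_))

InM-resp-∣∣ : ∀ n {x y} → ∣ x ∣ ≡ ∣ y ∣ → InM n x → InM n y
InM-resp-∣∣ n eq (inj₁ (k , n≡ , x≤k)) = inj₁ (k , n≡ , subst (_≤ k) eq x≤k)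
InM-resp-∣∣ n eq (inj₂ (k , n≡ , 1≤x , x≤k)) =
  inj₂ (k , n≡ , subst (1 ≤_) eq 1≤x , subst (_≤ k) eq x≤k)

InM-⟦⟧* : ∀ n a {x} → InM n x → InM n (⟦ a ⟧ *ℤ x)
InM-⟦⟧* n a {x} = InM-resp-∣∣ n {x} {⟦ a ⟧ *ℤ x} (sym (∣⟦⟧*∣ a x))

module _ (S : SignedSimpleGraph) (B : Orientation S) where

  orient-at : ∀ e s → σ S e ≡ neg (τ B e s · τ B e (flip s))
  orient-at e L = orient B e
  orient-at e R = trans (orient B e) (cong neg (·-comm (τ B e L) (τ B e R)))

  edge-condition-at⇔ : ∀ (γ : Fin (m S) → Side → ℤ) e s →
    (γ e s ≡ - (⟦ σ S e ⟧ *ℤ γ e (flip s))) ⇔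
    (⟦ τ B e s ⟧ *ℤ γ e s ≡ ⟦ τ B e (flip s) ⟧ *ℤ γ e (flip s))
  edge-condition-at⇔ γ e s rewrite orient-at e s = edge-condition⇔ (τ B e s) (τ B e (flip s))

  toVertex-at : ∀ {n} (γ : Fin (m S) → Side → ℤ) → IsEdgeColoring S n γ →
    ∀ e s → toVertex S B γ e ≡ ⟦ τ B e s ⟧ *ℤ γ e s
  toVertex-at γ _ e L = refl
  toVertex-at γ (_ , cond) e R = Equivalence.to (edge-condition-at⇔ γ e L) (cond e L)

  toVertex-injective : ∀ {n} (γ γ′ : Fin (m S) → Side → ℤ) →
    IsEdgeColoring S n γ → IsEdgeColoring S n γ′ →
    (∀ e → toVertex S B γ e ≡ toVertex S B γ′ e) → ∀ e s → γ e s ≡ γ′ e s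
  toVertex-injective γ γ′ H H′ eq e s = ⟦⟧*-injective (τ B e s)
    (trans (sym (toVertex-at γ H e s)) (trans (eq e) (toVertex-at γ′ H′ e s)))

  fromVertex : (Fin (m S) → ℤ) → Fin (m S) → Side → ℤ
  fromVertex c e s = ⟦ τ B e s ⟧ *ℤ c e

  fromVertex-isEdgeColoring : ∀ {n} c → IsVertexColoring (ΣL S B) n c →
    IsEdgeColoring S n (fromVertex c)
  fromVertex-isEdgeColoring c Hc =
    (λ e s → InM-⟦⟧* _ (τ B e s) (Hc e)) ,
    (λ e s → Equivalence.from (edge-condition-at⇔ (fromVertex c) e s)
      (trans (⟦⟧*-involutive (τ B e s) (c e))
             (sym (⟦⟧*-involutive (τ B e (flip s)) (c e)))))

  toVertex-fromVertex : ∀ c e → toVertex S B (fromVertex c) e ≡ c e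
  toVertex-fromVertex c e = ⟦⟧*-involutive (τ B e L) (c e)

  improper⇔ : ∀ {n} (γ : Fin (m S) → Side → ℤ) → IsEdgeColoring S n γ →
    ∀ e f (a : LineAdj S e f) → let (_ , s , t , _) = a in
    (toVertex S B γ e ≡ ⟦ lineSign S B a ⟧ *ℤ toVertex S B γ f) ⇔ (γ e s ≡ - γ f t)
  improper⇔ γ H e f (_ , s , t , _)
    rewrite toVertex-at γ H e s | toVertex-at γ H f t = line-condition⇔ (τ B e s) (τ B f t)

  antiproper⇔proper : ∀ {n} (γ : Fin (m S) → Side → ℤ) → IsEdgeColoring S n γ →
    IsAntiproper S γ ⇔ IsProper (ΣL S B) (toVertex S B γ)
  antiproper⇔proper γ H = mk⇔
    (λ ap e f a@(e≢f , s , t , v) →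
      contraposition (Equivalence.to (improper⇔ γ H e f a)) (ap e f s t e≢f v))
    (λ pr e f s t e≢f v →
      let a = (e≢f , s , t , v) in
      contraposition (Equivalence.from (improper⇔ γ H e f a)) (pr e f a))

mainTheorem6 :
    (S : SignedSimpleGraph) (B : Orientation S) (n : ℕ) → 1 ≤ n →
    -- the map is well defined: independent of the endpoint, lands in n-vertex colourings
    ((γ : Fin (m S) → Side → ℤ) → IsEdgeColoring S n γ →
      (∀ e s → toVertex S B γ e ≡ ⟦ τ B e s ⟧ *ℤ γ e s) ×
      IsVertexColoring (ΣL S B) n (toVertex S B γ)) ×
    -- injective on n-edge colourings
    ((γ γ′ : Fin (m S) → Side → ℤ) → IsEdgeColoring S n γ → IsEdgeColoring S n γ′ →
      (∀ e → toVertex S B γ e ≡ toVertex S B γ′ e) → ∀ e s → γ e s ≡ γ′ e s) ×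
    -- surjective onto n-vertex colourings of Σ_{L(B)}
    ((c : Fin (m S) → ℤ) → IsVertexColoring (ΣL S B) n c →
      ∃[ γ ] (IsEdgeColoring S n γ × (∀ e → toVertex S B γ e ≡ c e))) ×
    -- antiproper edge colourings ↔ proper vertex colourings
    ((γ : Fin (m S) → Side → ℤ) → IsEdgeColoring S n γ →
      (IsAntiproper S γ ⇔ IsProper (ΣL S B) (toVertex S B γ)))
mainTheorem6 S B n _ =
  (λ γ H → toVertex-at S B γ H , λ e → InM-⟦⟧* n (τ B e L) (proj₁ H e L)) ,
  toVertex-injective S B ,
  (λ c Hc → fromVertex S B c ,
    fromVertex-isEdgeColoring S B c Hc , toVertex-fromVertex S B c) ,
  antiproper⇔proper S B
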